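{- Let $t$ be a positive integer and let $A$ be a nonempty finite multiset of integers, with $\mathrm{diam}(A)=\max(A)-\min(A)$. If there exists a multiset $B$ of integers such that $A\oplus_t B=\mathbb{Z}$, then $B$ is periodic with a period $k$ satisfying \[k\le (t+1)^{\mathrm{diam}(A)}.\]
   Context: A multiset $S$ of integers is described by its weight function $w_S:\mathbb{Z}\to\mathbb{Z}_{\ge 0}$, where $w_S(n)$ is the number of occurrences of $n$ in $S$; "$n\in S$" means $w_S(n)>0$, and $\max(A)$, $\min(A)$ refer to the elements of positive weight. For a finite multiset $A$ and a multiset $B$, the representation function is $R_{A,B}(n)=\sum_{n=a+b,\ a\in A,\ b\in B} w_A(a)w_B(b)$. For a positive integer $t$, $A$ and $B$ are called $t$-complementing, written $A\oplus_t B=\mathbb{Z}$, if $A+B=\{a+b: a\in A, b\in B\}=\mathbb{Z}$ and $R_{A,B}(n)=t$ for all $n\in\mathbb{Z}$. A multiset $B$ is periodic with period $k\in\mathbb{Z}_{>0}$ if $w_B(n+k)=w_B(n)$ for all $n\in\mathbb{Z}$. -}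

module Defs where

open import Data.Nat as ℕ using (ℕ; suc; _^_)
open import Data.Integer as ℤ using (ℤ; _+_; _-_; _⊔_; _⊓_; ∣_∣)
open import Data.List using (List; []; _∷_; map)
open import Data.Nat.ListAction using (sum)
open import Data.List.Membership.Propositional using (_∈_)
open import Data.Product using (Σ; ∃; _×_; _,_)
open import Relation.Binary.PropositionalEquality using (_≡_)

Multiset : Set
Multiset = ℤ → ℕ

-- A finite multiset A is given as a list of its elements, listed with
-- multiplicity (w_A(a) = number of occurrences of a in the list).

-- Representation function R_{A,B}(n) = Σ_{a ∈ A (with mult.)} w_B(n - a)
--   = Σ_{a+b=n} w_A(a) w_B(b).
R : List ℤ → Multiset → ℤ → ℕ
R A wB n = sum (map (λ a → wB (n - a)) A)

SumsetIsℤ : List ℤ → Multiset → Set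
SumsetIsℤ A wB = ∀ n → Σ ℤ λ a → Σ ℤ λ b → a ∈ A × 0 ℕ.< wB b × a + b ≡ n

TComplementing : ℕ → List ℤ → Multiset → Set
TComplementing t A wB = SumsetIsℤ A wB × (∀ n → R A wB n ≡ t)

PeriodicWith : Multiset → ℕ → Set
PeriodicWith wB k = 0 ℕ.< k × (∀ n → wB (n + ℤ.+ k) ≡ wB n)

maxL : ℤ → List ℤ → ℤ
maxL x [] = x
maxL x (y ∷ ys) = x ⊔ maxL y ys

minL : ℤ → List ℤ → ℤ
minL x [] = x
minL x (y ∷ ys) = x ⊓ minL y ys

diam : ℤ → List ℤ → ℕ
diam x xs = ∣ maxL x xs - minL x xs ∣

{-# OPTIONS --safe #-}
module Submission where

-- Measured downwards from max A, the hypothesis says Σ_{u ∈ U} w(r + u) = t for every r, where the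
-- offsets U ⊆ [0, d] contain both 0 and d. Comparing this identity at two positions whose windows
-- w(r), …, w(r + d − 1) coincide, everything cancels except the extreme offset: a window determines
-- both the next and the previous value. As all values lie in [0, t], two of the windows at
-- 0, 1, …, (t + 1)^d coincide, and the two-sided recurrence makes their distance a period.

open import Defs
open import Data.Nat using (ℕ; suc; _^_; _≤_; _<_)
open import Data.Integer using (ℤ)
open import Data.List using (List; _∷_)
open import Data.Product using (Σ; _×_)

open import Data.Nat using (zero; z≤n; s≤s; _∸_)
open import Data.Nat.Properties
  using (_≟_; <-cmp; ≤-reflexive; ≤-trans; <-trans; <⇒≤; <⇒≢; ≤∧≢⇒<; m≤n⇒m<n∨m≡n; n<1+n; ≤-pred;
         +-mono-≤; +-mono-<-≤; +-mono-≤-<; m≤m+n; m≤n+m; m∸n≤m; m<n⇒0<n∸m)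
open import Data.Integer using (+_; -[1+_]; 0ℤ; 1ℤ; ∣_∣) renaming (suc to sucℤ)
import Data.Integer as Int
import Data.Integer.Properties as Intₚ
open import Data.Integer.Tactic.RingSolver using (solve-∀)
open import Data.List using ([]; map)
open import Data.List.Properties using (map-∘; map-cong-local)
open import Data.List.Membership.Propositional using (_∈_)
open import Data.List.Membership.Propositional.Properties using (∈-map⁺)
open import Data.List.Relation.Unary.All as All using (All; []; _∷_)
import Data.List.Relation.Unary.All.Properties as All
open import Data.List.Relation.Unary.Any as Any using (Any; here; there)
open import Data.Nat.ListAction using (sum)
open import Data.Fin using (Fin; zero; toℕ; fromℕ<; combine)
open import Data.Fin.Properties using (combine-injectiveˡ; combine-injectiveʳ; pigeonhole;
                                       fromℕ<-injective; toℕ<n)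
open import Data.Product using (_,_; ∃₂)
open import Data.Sum using (_⊎_; inj₁; inj₂)
open import Function using (_∘_)
open import Relation.Binary using (tri<; tri≈; tri>)
open import Relation.Binary.PropositionalEquality
open import Relation.Nullary using (contradiction; yes; no)

module _ {A : Set} {f g : A → ℕ} where

  sum-map-mono-≤ : ∀ {l} → All (λ a → f a ≤ g a) l → sum (map f l) ≤ sum (map g l)
  sum-map-mono-≤ []       = z≤n
  sum-map-mono-≤ (p ∷ ps) = +-mono-≤ p (sum-map-mono-≤ ps)

  sum-map-mono-< : ∀ {l} → All (λ a → f a ≤ g a) l → Any (λ a → f a < g a) l →
                   sum (map f l) < sum (map g l)
  sum-map-mono-< (_ ∷ ps) (here q)  = +-mono-<-≤ q (sum-map-mono-≤ ps)
  sum-map-mono-< (p ∷ ps) (there q) = +-mono-≤-< p (sum-map-mono-< ps q)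

∈⇒≤-sum-map : ∀ {A : Set} (f : A → ℕ) {a l} → a ∈ l → f a ≤ sum (map f l)
∈⇒≤-sum-map f (here refl) = m≤m+n _ _
∈⇒≤-sum-map f (there a∈l) = ≤-trans (∈⇒≤-sum-map f a∈l) (m≤n+m _ _)

sum-map-<-at : ∀ {e l} (f g : ℕ → ℕ) → e ∈ l → f e < g e → All (λ u → u ≢ e → f u ≡ g u) l →
               sum (map f l) < sum (map g l)
sum-map-<-at {e} f g e∈l lt agree =
  sum-map-mono-< (All.map dominated agree) (Any.map (λ { refl → lt }) e∈l)
  where
  dominated : ∀ {u} → (u ≢ e → f u ≡ g u) → f u ≤ g u
  dominated {u} f≡g with u ≟ e
  ... | yes refl = <⇒≤ lt
  ... | no u≢e   = ≤-reflexive (f≡g u≢e)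

sum-map-cancel : ∀ {e l} (f g : ℕ → ℕ) → e ∈ l → All (λ u → u ≢ e → f u ≡ g u) l →
                 sum (map f l) ≡ sum (map g l) → f e ≡ g e
sum-map-cancel {e} f g e∈l agree sums with <-cmp (f e) (g e)
... | tri< lt _ _ = contradiction sums (<⇒≢ (sum-map-<-at f g e∈l lt agree))
... | tri≈ _ eq _ = eq
... | tri> _ _ gt =
  contradiction (sym sums) (<⇒≢ (sum-map-<-at g f e∈l gt (All.map (sym ∘_) agree)))

encode : ∀ {q} n → (ℕ → Fin q) → Fin (q ^ n)
encode zero    f = zero
encode (suc n) f = combine (f 0) (encode n (f ∘ suc))

encode-injective : ∀ {q} n {f g : ℕ → Fin q} → encode n f ≡ encode n g → ∀ j → j < n → f j ≡ g j
encode-injective (suc n) {f} {g} eq zero _ =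
  combine-injectiveˡ (f 0) (encode n (f ∘ suc)) (g 0) (encode n (g ∘ suc)) eq
encode-injective (suc n) {f} {g} eq (suc j) (s≤s j<n) =
  encode-injective n
    (combine-injectiveʳ (f 0) (encode n (f ∘ suc)) (g 0) (encode n (g ∘ suc)) eq) j j<n

ℤ-induction : (P : ℤ → Set) → (∀ z → P z → P (sucℤ z)) → (∀ z → P (sucℤ z) → P z) →
              P 0ℤ → ∀ z → P z
ℤ-induction P up down p₀ (+ zero)      = p₀
ℤ-induction P up down p₀ (+ suc n)     = up (+ n) (ℤ-induction P up down p₀ (+ n))
ℤ-induction P up down p₀ -[1+ zero ]   = down -[1+ zero ] p₀
ℤ-induction P up down p₀ -[1+ suc n ]  = down -[1+ suc n ] (ℤ-induction P up down p₀ -[1+ n ])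

module Windows (w : ℤ → ℕ) (d : ℕ) where
  open Int using (_+_; _-_)

  SameWindow : ℤ → ℤ → Set
  SameWindow r s = ∀ j → j < d → w (r + + j) ≡ w (s + + j)

  sucℤ-+ : ∀ r j → sucℤ r + + j ≡ r + + suc j
  sucℤ-+ r j = ring r (+ j)
    where ring : ∀ r z → (1ℤ + r) + z ≡ r + (1ℤ + z)
          ring = solve-∀

  repeatedWindow : ∀ t → (∀ z → w z ≤ t) →
                   ∃₂ λ i j → i < j × j ≤ suc t ^ d × SameWindow (+ i) (+ j)
  repeatedWindow t w≤t with pigeonhole (n<1+n (suc t ^ d)) window
    where
    window : Fin (suc (suc t ^ d)) → Fin (suc t ^ d)
    window i = encode d (λ j → fromℕ< (s≤s (w≤t (+ toℕ i + + j))))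
  ... | i , j , i<j , same = toℕ i , toℕ j , i<j , ≤-pred (toℕ<n j) , λ k k<d →
    fromℕ<-injective _ _ _ _ (encode-injective d same k k<d)

  module Recurrence
    (extendʳ : ∀ r s → SameWindow r s → w (r + + d) ≡ w (s + + d))
    (extendˡ : ∀ r s → SameWindow (sucℤ r) (sucℤ s) → w r ≡ w s)
    where

    private
      +-sucℤ : ∀ r z → r + sucℤ z ≡ sucℤ (r + z)
      +-sucℤ = ring
        where ring : ∀ r z → r + (1ℤ + z) ≡ 1ℤ + (r + z)
              ring = solve-∀

    SameWindow-suc : ∀ {r s} → SameWindow r s → SameWindow (sucℤ r) (sucℤ s)
    SameWindow-suc {r} {s} same j j<d =
      subst₂ (λ a b → w a ≡ w b) (sym (sucℤ-+ r j)) (sym (sucℤ-+ s j)) (next (m≤n⇒m<n∨m≡n j<d))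
      where
      next : suc j < d ⊎ suc j ≡ d → w (r + + suc j) ≡ w (s + + suc j)
      next (inj₁ j+1<d) = same (suc j) j+1<d
      next (inj₂ j+1≡d) = subst (λ k → w (r + + k) ≡ w (s + + k)) (sym j+1≡d) (extendʳ r s same)

    SameWindow-pred : ∀ {r s} → SameWindow (sucℤ r) (sucℤ s) → SameWindow r s
    SameWindow-pred {r} {s} same zero _ =
      subst₂ (λ a b → w a ≡ w b) (sym (Intₚ.+-identityʳ r)) (sym (Intₚ.+-identityʳ s))
        (extendˡ r s same)
    SameWindow-pred {r} {s} same (suc j) j+1<d =
      subst₂ (λ a b → w a ≡ w b) (sucℤ-+ r j) (sucℤ-+ s j) (same j (<-trans (n<1+n j) j+1<d))

    SameWindow-translate : ∀ {r s} → SameWindow r s → ∀ z → SameWindow (r + z) (s + z)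
    SameWindow-translate {r} {s} same = ℤ-induction (λ z → SameWindow (r + z) (s + z)) up down
      (subst₂ SameWindow (sym (Intₚ.+-identityʳ r)) (sym (Intₚ.+-identityʳ s)) same)
      where
      up : ∀ z → SameWindow (r + z) (s + z) → SameWindow (r + sucℤ z) (s + sucℤ z)
      up z = subst₂ SameWindow (sym (+-sucℤ r z)) (sym (+-sucℤ s z)) ∘ SameWindow-suc {r + z} {s + z}
      down : ∀ z → SameWindow (r + sucℤ z) (s + sucℤ z) → SameWindow (r + z) (s + z)
      down z = SameWindow-pred {r + z} {s + z} ∘ subst₂ SameWindow (+-sucℤ r z) (+-sucℤ s z)

    SameWindow⇒periodic : ∀ {r s} → SameWindow r s → ∀ n → w (n + (s - r)) ≡ w n
    SameWindow⇒periodic {r} {s} same n =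
      subst₂ (λ a b → w a ≡ w b) (shifted s n r (+ d)) (unshifted r n (+ d))
        (sym (extendʳ (r + z) (s + z) (SameWindow-translate {r} {s} same z)))
      where
      z = n - r - + d
      shifted : ∀ s n r d → s + (n - r - d) + d ≡ n + (s - r)
      shifted = solve-∀
      unshifted : ∀ r n d → r + (n - r - d) + d ≡ n
      unshifted = solve-∀

module Tiling (w : ℤ → ℕ) (t d : ℕ) (us : List ℕ)
  (us≤d : All (_≤ d) us) (0∈us : 0 ∈ us) (d∈us : d ∈ us)
  (tiles : ∀ r → sum (map (λ u → w (r Int.+ + u)) us) ≡ t)
  where
  open Int using (_+_; _-_)
  open Windows w d

  bounded : ∀ z → w z ≤ t
  bounded z = subst₂ _≤_ (cong w (Intₚ.+-identityʳ z)) (tiles z)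
    (∈⇒≤-sum-map (λ u → w (z + + u)) 0∈us)

  extendʳ : ∀ r s → SameWindow r s → w (r + + d) ≡ w (s + + d)
  extendʳ r s same = sum-map-cancel (λ u → w (r + + u)) (λ u → w (s + + u)) d∈us
    (All.map (λ u≤d u≢d → same _ (≤∧≢⇒< u≤d u≢d)) us≤d) (trans (tiles r) (sym (tiles s)))

  extendˡ : ∀ r s → SameWindow (sucℤ r) (sucℤ s) → w r ≡ w s
  extendˡ r s same = subst₂ (λ a b → w a ≡ w b) (Intₚ.+-identityʳ r) (Intₚ.+-identityʳ s)
    (sum-map-cancel (λ u → w (r + + u)) (λ u → w (s + + u)) 0∈us
      (All.map agree us≤d) (trans (tiles r) (sym (tiles s))))
    where
    agree : ∀ {u} → u ≤ d → u ≢ 0 → w (r + + u) ≡ w (s + + u)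
    agree {zero}  _     u≢0 = contradiction refl u≢0
    agree {suc u} u+1≤d _   = subst₂ (λ a b → w a ≡ w b) (sucℤ-+ r u) (sucℤ-+ s u) (same u u+1≤d)

  periodic : Σ ℕ λ k → PeriodicWith w k × k ≤ suc t ^ d
  periodic with repeatedWindow t bounded
  ... | i , j , i<j , j≤bound , same =
    j ∸ i , (m<n⇒0<n∸m i<j , period) , ≤-trans (m∸n≤m j i) j≤bound
    where
    open Recurrence extendʳ extendˡ
    +j-+i : + j - + i ≡ + (j ∸ i)
    +j-+i = trans (Intₚ.[+m]-[+n]≡m⊖n j i) (Intₚ.⊖-≥ (<⇒≤ i<j))
    period : ∀ n → w (n + + (j ∸ i)) ≡ w n
    period n = subst (λ p → w (n + p) ≡ w n) +j-+i (SameWindow⇒periodic {+ i} {+ j} same n)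

maxL-∈ : ∀ x xs → maxL x xs ∈ x ∷ xs
maxL-∈ x []       = here refl
maxL-∈ x (y ∷ ys) with Intₚ.⊔-sel x (maxL y ys)
... | inj₁ x⊔m≡x = here x⊔m≡x
... | inj₂ x⊔m≡m = there (subst (_∈ y ∷ ys) (sym x⊔m≡m) (maxL-∈ y ys))

minL-∈ : ∀ x xs → minL x xs ∈ x ∷ xs
minL-∈ x []       = here refl
minL-∈ x (y ∷ ys) with Intₚ.⊓-sel x (minL y ys)
... | inj₁ x⊓m≡x = here x⊓m≡x
... | inj₂ x⊓m≡m = there (subst (_∈ y ∷ ys) (sym x⊓m≡m) (minL-∈ y ys))

maxL-upper : ∀ x xs → All (Int._≤ maxL x xs) (x ∷ xs)
maxL-upper x []       = Intₚ.≤-refl ∷ []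
maxL-upper x (y ∷ ys) = Intₚ.i≤i⊔j x (maxL y ys) ∷
  All.map (λ a≤m → Intₚ.≤-trans a≤m (Intₚ.i≤j⊔i x (maxL y ys))) (maxL-upper y ys)

minL-lower : ∀ x xs → All (minL x xs Int.≤_) (x ∷ xs)
minL-lower x []       = Intₚ.≤-refl ∷ []
minL-lower x (y ∷ ys) = Intₚ.i⊓j≤i x (minL y ys) ∷
  All.map (Intₚ.≤-trans (Intₚ.i⊓j≤j x (minL y ys))) (minL-lower y ys)

module Offsets (x : ℤ) (xs : List ℤ) where
  open Int using (_+_; _-_; -_)

  offset : ℤ → ℕ
  offset a = ∣ maxL x xs - a ∣

  offsets : List ℕ
  offsets = map offset (x ∷ xs)

  +offset : ∀ {a} → a Int.≤ maxL x xs → + offset a ≡ maxL x xs - a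
  +offset = Intₚ.0≤i⇒+∣i∣≡i ∘ Intₚ.i≤j⇒0≤j-i

  offsets≤diam : All (_≤ diam x xs) offsets
  offsets≤diam = All.map⁺ (All.zipWith offset≤diam (minL-lower x xs , maxL-upper x xs))
    where
    offset≤diam : ∀ {a} → minL x xs Int.≤ a × a Int.≤ maxL x xs → offset a ≤ diam x xs
    offset≤diam (min≤a , a≤max) = Intₚ.drop‿+≤+
      (subst₂ Int._≤_ (sym (+offset a≤max)) (sym (+offset (Intₚ.≤-trans min≤a a≤max)))
        (Intₚ.+-monoʳ-≤ (maxL x xs) (Intₚ.neg-mono-≤ min≤a)))

  0∈offsets : 0 ∈ offsets
  0∈offsets = subst (_∈ offsets) (cong ∣_∣ (Intₚ.+-inverseʳ (maxL x xs)))
    (∈-map⁺ offset (maxL-∈ x xs))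

  diam∈offsets : diam x xs ∈ offsets
  diam∈offsets = ∈-map⁺ offset (minL-∈ x xs)

  R≡sum-offsets : ∀ w r → R (x ∷ xs) w (r + maxL x xs) ≡ sum (map (λ u → w (r + + u)) offsets)
  R≡sum-offsets w r =
    cong sum (trans (map-cong-local (All.map shift (maxL-upper x xs))) (map-∘ (x ∷ xs)))
    where
    shift : ∀ {a} → a Int.≤ maxL x xs → w (r + maxL x xs - a) ≡ w (r + + offset a)
    shift {a} a≤max = cong w
      (trans (Intₚ.+-assoc r (maxL x xs) (- a)) (cong (λ i → r + i) (sym (+offset a≤max))))

theorem4 : (t : ℕ) → 0 < t → (x : ℤ) → (xs : List ℤ) → (wB : Multiset) →
    TComplementing t (x ∷ xs) wB →
    Σ ℕ λ k → PeriodicWith wB k × k ≤ suc t ^ diam x xs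
theorem4 t _ x xs w (_ , R≡t) = periodic
  where
  open Offsets x xs
  open Tiling w t (diam x xs) offsets offsets≤diam 0∈offsets diam∈offsets
    (λ r → trans (sym (R≡sum-offsets w r)) (R≡t (r Int.+ maxL x xs)))
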